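{- Let $n$ be a positive integer and let $G$ be a finite simple graph with chromatic number $\chi(G)=n$. Then for every coloring of the edges of $G$ with $2$ colors, there is a monochromatic tree on $n$ vertices in $G$ (that is, a subtree of $G$ with $n$ vertices all of whose edges receive the same color).
   Context: The chromatic number $\chi(G)$ of a graph $G$ is the minimum number $m$ such that the vertices of $G$ can be colored with $m$ colors so that no two adjacent vertices receive the same color. Edge colorings are arbitrary (not necessarily proper). -}

module Defs where

open import Data.Nat using (ℕ; zero; suc; _<_)
open import Data.Fin using (Fin; toℕ)
open import Data.Bool using (Bool; true; false)
open import Data.Product using (Σ; ∃; _×_; _,_)
open import Relation.Binary.PropositionalEquality using (_≡_; _≢_)
open import Relation.Nullary using (¬_)
open import Function.Definitions using (Injective)

record Graph (v : ℕ) : Set where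
  field
    adj   : Fin v → Fin v → Bool
    sym   : ∀ x y → adj x y ≡ adj y x
    irrefl : ∀ x → adj x x ≡ false

open Graph public

Adj : ∀ {v} → Graph v → Fin v → Fin v → Set
Adj G x y = adj G x y ≡ true

ProperColoring : ∀ {v} → Graph v → ℕ → Set
ProperColoring {v} G m =
  Σ (Fin v → Fin m) λ c → ∀ x y → Adj G x y → c x ≢ c y

Colorable : ∀ {v} → Graph v → ℕ → Set
Colorable G m = ProperColoring G m

ChromaticNumber : ∀ {v} → Graph v → ℕ → Set
ChromaticNumber G n = Colorable G n × (∀ m → m < n → ¬ Colorable G m)

-- an edge colouring of G with k colours: a colour for each edge {x,y},
-- encoded as a function on ordered pairs that is symmetric on edges
-- (values on non-edges are irrelevant)
EdgeColoring : ∀ {v} → Graph v → ℕ → Set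
EdgeColoring {v} G k =
  Σ (Fin v → Fin v → Fin k) λ f → ∀ x y → Adj G x y → f x y ≡ f y x

data Walk {v} (G : Graph v) : Fin v → Fin v → Set where
  here : ∀ {x} → Walk G x x
  step : ∀ {x y z} → Adj G x y → Walk G y z → Walk G x z

Connected : ∀ {v} → Graph v → Set
Connected G = ∀ x y → Walk G x y

-- a cycle of length k+3 (≥ 3): pairwise distinct vertices c 0, …, c (k+2),
-- consecutive ones adjacent, and the last adjacent to the first
HasCycle : ∀ {v} → Graph v → Set
HasCycle {v} G =
  Σ ℕ λ k → Σ (Fin (suc (suc (suc k))) → Fin v) λ c →
    Injective _≡_ _≡_ c ×
    (∀ (i j : Fin (suc (suc (suc k)))) → suc (toℕ i) ≡ toℕ j → Adj G (c i) (c j)) ×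
    (∀ (i j : Fin (suc (suc (suc k)))) → toℕ i ≡ suc (suc k) → toℕ j ≡ 0 →
       Adj G (c i) (c j))

Acyclic : ∀ {v} → Graph v → Set
Acyclic G = ¬ HasCycle G

IsTree : ∀ {n} → Graph n → Set
IsTree T = Connected T × Acyclic T

-- G contains a tree on n vertices all of whose edges get colour κ under f:
-- a tree T on Fin n together with an injective map of its vertices into G
-- sending each edge of T to an edge of G of colour κ.
MonochromaticTree : ∀ {v k} (G : Graph v) → (Fin v → Fin v → Fin k) → ℕ → Set
MonochromaticTree {v} {k} G f n =
  Σ (Graph n) λ T → IsTree T × Σ (Fin k) λ κ → Σ (Fin n → Fin v) λ e →
    Injective _≡_ _≡_ e ×
    (∀ i j → Adj T i j → Adj G (e i) (e j) × f (e i) (e j) ≡ κ)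

module Submission where

-- Let χ(G) = d + 1 and let the edges of G be coloured red and blue.
-- Explore the red and the blue component of every vertex.  If some
-- exploration reaches d + 1 vertices, its exploration tree (each vertex
-- hangs from the vertex it was discovered from) is a monochromatic tree on
-- d + 1 vertices.  Otherwise every monochromatic component has at most d
-- vertices, so the red components and the blue components form two
-- partitions of V(G) into classes of size ≤ d.  By König's edge-colouring
-- theorem (in the bipartite multigraph of classes, with one edge per
-- vertex of G) some colouring V(G) → Fin d is injective on every class.
-- The two ends of an edge lie in a common class, so this is a proper
-- d-colouring of G, contradicting χ(G) = d + 1.

open import Defs hiding (sym; irrefl)
open import Data.Nat using (ℕ; zero; suc; _<_; _≤_; _∸_; _+_; z≤n; s≤s; s≤s⁻¹; _<?_)
open import Data.Nat.Properties
  using (≤-refl; ≤-trans; <⇒≤; ≰⇒>; ≤∧≢⇒<; <-irrefl; n<1+n; +-suc; +-identityʳ; m≤n+m; +-monoˡ-≤;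
         m+1+n≢n; m∸n+n≡m; m≤n⇒m<n∨m≡n; _≤?_)
import Data.Nat.Properties as ℕP
open import Data.Fin using (Fin; zero; suc; toℕ; fromℕ<; fromℕ; inject₁)
import Data.Fin.Properties as FinP
open import Data.Fin.Properties
  using (any?; pigeonhole; toℕ-injective; toℕ<n; toℕ-fromℕ<; toℕ-inject₁; toℕ-fromℕ)
open import Data.Fin.Permutation.Components using (transpose; transpose-inverse)
open import Data.Vec.Functional using (updateAt)
open import Data.Vec.Functional.Properties using (updateAt-updates; updateAt-minimal)
open import Data.List using (List; []; _∷_; length; lookup; map; filter)
open import Data.List.Properties using (filter-notAll; length-map)
open import Data.List.Relation.Unary.Any as Any using (Any)
open import Data.List.Relation.Unary.Any.Properties using (lookup-index)
open import Data.List.Membership.Propositional using (_∈_; _∉_)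
open import Data.List.Membership.Propositional.Properties using (∈-lookup; ∈-filter⁺; ∈-map⁺)
open import Data.Bool using (true; false)
import Data.Bool.Properties as BoolP
open import Data.Product using (Σ; ∃₂; _×_; _,_; proj₁; proj₂)
open import Data.Sum using (_⊎_; inj₁; inj₂; [_,_]′) renaming (swap to ⊎-swap)
open import Data.Empty using (⊥; ⊥-elim)
open import Relation.Nullary using (¬_; Dec; yes; no; does; ¬?)
open import Relation.Nullary.Decidable using (_×-dec_; _⊎-dec_; dec-true; dec-false)
open import Relation.Binary.PropositionalEquality
open import Relation.Binary.Construct.Closure.ReflexiveTransitive using (Star; ε; _◅_; _◅◅_; reverse)
open import Function using (_∘_; const; id)

module _ {v : ℕ} (G : Graph v) where

  adj-sym : ∀ {a b} → Adj G a b → Adj G b a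
  adj-sym {a} {b} p = trans (Graph.sym G b a) p

  adj⇒≢ : ∀ {a b} → Adj G a b → a ≢ b
  adj⇒≢ {a} ab refl with trans (sym (Graph.irrefl G a)) ab
  ... | ()

  star⇒walk : ∀ {a b} → Star (Adj G) a b → Walk G a b
  star⇒walk ε = here
  star⇒walk (e ◅ es) = step e (star⇒walk es)

module RelGraph {L : ℕ} {E : Fin L → Fin L → Set} (E? : ∀ i j → Dec (E i j))
  (E-sym : ∀ {i j} → E i j → E j i) (E-irrefl : ∀ i → ¬ E i i) where

  graph : Graph L
  graph = record { adj = λ i j → does (E? i j) ; sym = symmetric ; irrefl = irreflexive }
    where
    symmetric : ∀ i j → does (E? i j) ≡ does (E? j i)
    symmetric i j with E? i j | E? j i
    ... | yes _  | yes _  = refl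
    ... | no _   | no _   = refl
    ... | yes e  | no ¬e  = ⊥-elim (¬e (E-sym e))
    ... | no ¬e  | yes e  = ⊥-elim (¬e (E-sym e))
    irreflexive : ∀ i → does (E? i i) ≡ false
    irreflexive i with E? i i
    ... | yes e = ⊥-elim (E-irrefl i e)
    ... | no _  = refl

  adj⇒rel : ∀ {i j} → Adj graph i j → E i j
  adj⇒rel {i} {j} a with E? i j
  ... | yes e = e

  rel⇒adj : ∀ {i j} → E i j → Adj graph i j
  rel⇒adj {i} {j} e with E? i j
  ... | yes _ = refl
  ... | no ¬e = ⊥-elim (¬e e)

argmin : ∀ {M} (g : Fin (suc M) → ℕ) → Σ (Fin (suc M)) λ i → ∀ j → g i ≤ g j
argmin {zero} g = zero , λ { zero → ≤-refl }
argmin {suc M} g with argmin (g ∘ suc)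
... | i , min with g zero ≤? g (suc i)
...   | yes le = zero , λ { zero → ≤-refl ; (suc j) → ≤-trans le (min j) }
...   | no nle = suc i , λ { zero → <⇒≤ (≰⇒> nle) ; (suc j) → min j }

-- In a cycle c 0, …, c (k+2) every vertex c i has two cycle neighbours at
-- different positions (its predecessor and its successor); this is where
-- the length ≥ 3 of a cycle is used.
module CycleNeighbours {L : ℕ} (T : Graph L) (k : ℕ) (c : Fin (suc (suc (suc k))) → Fin L)
  (consecutive : ∀ (i j : Fin (suc (suc (suc k)))) → suc (toℕ i) ≡ toℕ j → Adj T (c i) (c j))
  (closing : ∀ (i j : Fin (suc (suc (suc k)))) → toℕ i ≡ suc (suc k) → toℕ j ≡ 0 →
     Adj T (c i) (c j)) where

  Pos : Set
  Pos = Fin (suc (suc (suc k)))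

  successor : (i : Pos) → Σ Pos λ b →
    Adj T (c i) (c b) × (toℕ b ≡ suc (toℕ i) ⊎ (toℕ i ≡ suc (suc k) × toℕ b ≡ 0))
  successor i with toℕ i ℕP.≟ suc (suc k)
  ... | yes last = zero , closing i zero last refl , inj₂ (last , refl)
  ... | no ¬last = fromℕ< lt , consecutive i (fromℕ< lt) (sym (toℕ-fromℕ< lt)) , inj₁ (toℕ-fromℕ< lt)
    where lt : suc (toℕ i) < suc (suc (suc k))
          lt = s≤s (≤∧≢⇒< (s≤s⁻¹ (toℕ<n i)) ¬last)

  predecessor : (i : Pos) → Σ Pos λ a →
    Adj T (c i) (c a) × (toℕ i ≡ suc (toℕ a) ⊎ (toℕ i ≡ 0 × toℕ a ≡ suc (suc k)))
  predecessor zero = fromℕ (suc (suc k))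
    , adj-sym T (closing (fromℕ (suc (suc k))) zero (toℕ-fromℕ _) refl) , inj₂ (refl , toℕ-fromℕ _)
  predecessor (suc i) = inject₁ i
    , adj-sym T (consecutive (inject₁ i) (suc i) (cong suc (toℕ-inject₁ i)))
    , inj₁ (cong suc (sym (toℕ-inject₁ i)))

  distinct : ∀ (t ta tb : ℕ) → (t ≡ suc ta ⊎ (t ≡ 0 × ta ≡ suc (suc k))) →
             (tb ≡ suc t ⊎ (t ≡ suc (suc k) × tb ≡ 0)) → ta ≢ tb
  distinct t ta tb (inj₁ p) (inj₁ q) ta≡tb =
    m+1+n≢n 1 (sym (trans ta≡tb (trans q (cong suc p))))
  distinct t ta tb (inj₁ p) (inj₂ (q , q′)) refl with trans (sym q) (trans p (cong suc q′))
  ... | ()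
  distinct t ta tb (inj₂ (p , p′)) (inj₁ q) ta≡tb with trans (sym p′) (trans ta≡tb (trans q (cong suc p)))
  ... | ()
  distinct t ta tb (inj₂ (p , _)) (inj₂ (q , _)) _ with trans (sym p) q
  ... | ()

  neighbours : ∀ i → Σ Pos λ a → Σ Pos λ b → Adj T (c i) (c a) × Adj T (c i) (c b) × a ≢ b
  neighbours i with predecessor i | successor i
  ... | a , ia , pa | b , ib , pb = a , b , ia , ib , λ a≡b → distinct _ _ _ pa pb (cong toℕ a≡b)

module ParentTree {L : ℕ} (par : Fin L → Fin L)
  (climbs : ∀ i → par i ≡ i ⊎ toℕ i < toℕ (par i))
  (r : Fin L) (fixed⇒root : ∀ i → par i ≡ i → i ≡ r) where

  TreeEdge : Fin L → Fin L → Set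
  TreeEdge i j = i ≢ j × (par i ≡ j ⊎ par j ≡ i)

  TreeEdge? : ∀ i j → Dec (TreeEdge i j)
  TreeEdge? i j = ¬? (i FinP.≟ j) ×-dec (par i FinP.≟ j ⊎-dec par j FinP.≟ i)

  open RelGraph TreeEdge? (λ (i≢j , e) → i≢j ∘ sym , ⊎-swap e) (λ i (i≢i , _) → i≢i refl)
    renaming (graph to tree) public

  -- following parents from i reaches the root: every step raises the
  -- position, so any fuel k with L ≤ toℕ i + k suffices
  to-root : ∀ k i → L ≤ toℕ i + k → Star (Adj tree) i r
  to-root k i h with climbs i
  ... | inj₁ fixed = subst (Star (Adj tree) i) (fixed⇒root i fixed) ε
  to-root zero i h | inj₂ lt = ⊥-elim (<-irrefl refl (≤-trans (toℕ<n i) (subst (L ≤_) (+-identityʳ (toℕ i)) h)))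
  to-root (suc k) i h | inj₂ lt =
    rel⇒adj ((λ i≡pi → <-irrefl (cong toℕ i≡pi) lt) , inj₁ refl)
    ◅ to-root k (par i) (≤-trans h (subst (_≤ toℕ (par i) + k) (sym (+-suc (toℕ i) k)) (+-monoˡ-≤ k lt)))

  connected : Connected tree
  connected i j = star⇒walk tree
    (to-root L i (m≤n+m L (toℕ i)) ◅◅ reverse (adj-sym tree) (to-root L j (m≤n+m L (toℕ j))))

  upward-edge : ∀ u w → toℕ u ≤ toℕ w → Adj tree u w → par u ≡ w
  upward-edge u w u≤w a with adj⇒rel a
  ... | _ , inj₁ pu≡w = pu≡w
  ... | u≢w , inj₂ pw≡u with climbs w
  ...   | inj₁ fixed = ⊥-elim (u≢w (trans (sym pw≡u) fixed))
  ...   | inj₂ lt = ⊥-elim (<-irrefl refl (≤-trans (subst (λ z → toℕ w < toℕ z) pw≡u lt) u≤w))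

  -- at a cycle vertex of minimal position both cycle neighbours would be
  -- its parent, contradicting injectivity of the cycle
  acyclic : Acyclic tree
  acyclic (k , c , c-inj , consecutive , closing) with argmin (toℕ ∘ c)
  ... | i , min with CycleNeighbours.neighbours tree k c consecutive closing i
  ... | a , b , ia , ib , a≢b =
    a≢b (c-inj (trans (sym (upward-edge (c i) (c a) (min a) ia)) (upward-edge (c i) (c b) (min b) ib)))

  is-tree : IsTree tree
  is-tree = connected , acyclic

-- y occurs in ws, at an explicitly given position (explored vertex sets are
-- lists, and positions give the vertices of exploration trees)
Mem : ∀ {A : Set} → A → List A → Set
Mem y ws = Σ (Fin (length ws)) λ j → lookup ws j ≡ y

mem? : ∀ {N} (y : Fin N) ws → Dec (Mem y ws)
mem? y ws = any? (λ j → lookup ws j FinP.≟ y)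

unsnoc : ∀ {A : Set} {E : A → A → Set} {x y} → Star E x y →
         x ≡ y ⊎ Σ A λ p → Star E x p × E p y
unsnoc ε = inj₁ refl
unsnoc (e ◅ es) with unsnoc es
... | inj₁ refl = inj₂ (_ , ε , e)
... | inj₂ (p , es′ , e′) = inj₂ (p , e ◅ es′ , e′)

module Exploration {N : ℕ} (E : Fin N → Fin N → Set) where

  Closed : List (Fin N) → Set
  Closed ws = ∀ j y → E (lookup ws j) y → Mem y ws

  closed-reach : ∀ {ws a b} → Closed ws → Mem a ws → Star E a b → Mem b ws
  closed-reach cl m ε = m
  closed-reach {ws} cl (j , refl) (e ◅ es) = closed-reach {ws} cl (cl j _ e) es

  -- ws (newest vertex first) lists distinct vertices, each one after x
  -- joined by an E-step from a vertex listed before it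
  data Explored (x : Fin N) : List (Fin N) → Set where
    start  : Explored x (x ∷ [])
    extend : ∀ {ws} y → Explored x ws → ¬ Mem y ws →
             (j : Fin (length ws)) → E (lookup ws j) y → Explored x (y ∷ ws)

  explored-injective : ∀ {x ws} → Explored x ws → ∀ i j → lookup ws i ≡ lookup ws j → i ≡ j
  explored-injective start zero zero _ = refl
  explored-injective (extend y g _ _ _) zero zero _ = refl
  explored-injective (extend y g fresh _ _) zero (suc j) y≡ = ⊥-elim (fresh (j , sym y≡))
  explored-injective (extend y g fresh _ _) (suc i) zero ≡y = ⊥-elim (fresh (i , ≡y))
  explored-injective (extend y g _ _ _) (suc i) (suc j) eq = cong suc (explored-injective g i j eq)

  explored-start : ∀ {x ws} → Explored x ws → Mem x ws
  explored-start start = zero , refl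
  explored-start (extend y g _ _ _) with explored-start g
  ... | j , eq = suc j , eq

  explored-reach : ∀ {x ws} → Explored x ws → ∀ j → Star E x (lookup ws j)
  explored-reach start zero = ε
  explored-reach (extend y g _ j e) zero = explored-reach g j ◅◅ (e ◅ ε)
  explored-reach (extend y g _ _ _) (suc i) = explored-reach g i

  member-reach : ∀ {x ws y} → Explored x ws → Mem y ws → Star E x y
  member-reach g (j , refl) = explored-reach g j

  -- the exploration order as a rooted tree: each vertex points to the
  -- vertex it was reached from, which sits at a larger list position
  parent : ∀ {x ws} → Explored x ws → Fin (length ws) → Fin (length ws)
  parent start zero = zero
  parent (extend y g _ j _) zero = suc j
  parent (extend y g _ _ _) (suc i) = suc (parent g i)

  root : ∀ {x ws} → Explored x ws → Fin (length ws)
  root start = zero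
  root (extend _ g _ _ _) = suc (root g)

  parent-climbs : ∀ {x ws} (g : Explored x ws) i → parent g i ≡ i ⊎ toℕ i < toℕ (parent g i)
  parent-climbs start zero = inj₁ refl
  parent-climbs (extend y g _ j _) zero = inj₂ (s≤s z≤n)
  parent-climbs (extend y g _ _ _) (suc i) with parent-climbs g i
  ... | inj₁ fixed = inj₁ (cong suc fixed)
  ... | inj₂ lt = inj₂ (s≤s lt)

  fixed⇒root : ∀ {x ws} (g : Explored x ws) i → parent g i ≡ i → i ≡ root g
  fixed⇒root start zero _ = refl
  fixed⇒root (extend y g _ j _) zero ()
  fixed⇒root (extend y g _ _ _) (suc i) fixed = cong suc (fixed⇒root g i (FinP.suc-injective fixed))

  parent-edge : ∀ {x ws} (g : Explored x ws) i → parent g i ≢ i → E (lookup ws (parent g i)) (lookup ws i)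
  parent-edge start zero not-fixed = ⊥-elim (not-fixed refl)
  parent-edge (extend y g _ j e) zero _ = e
  parent-edge (extend y g _ _ _) (suc i) not-fixed = parent-edge g i (not-fixed ∘ cong suc)

  module _ (E? : ∀ a b → Dec (E a b)) where

    Extension : List (Fin N) → Set
    Extension ws = Σ (Fin N) λ y → ¬ Mem y ws × Σ (Fin (length ws)) λ j → E (lookup ws j) y

    extension? : ∀ ws → Dec (Extension ws)
    extension? ws = any? (λ y → ¬? (mem? y ws) ×-dec any? (λ j → E? (lookup ws j) y))

    stuck⇒closed : ∀ ws → ¬ Extension ws → Closed ws
    stuck⇒closed ws stuck j y e with mem? y ws
    ... | yes m = m
    ... | no ¬m = ⊥-elim (stuck (y , ¬m , j , e))

    Outcome : Fin N → ℕ → Set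
    Outcome x B = (Σ _ λ ws → Explored x ws × length ws ≡ B)
                ⊎ (Σ _ λ ws → Explored x ws × length ws < B × Closed ws)

    explore-from : ∀ {x B} k ws → Explored x ws → k + length ws ≡ B → Outcome x B
    explore-from zero ws g size = inj₁ (ws , g , size)
    explore-from (suc k) ws g size with extension? ws
    ... | yes (y , fresh , j , e) = explore-from k (y ∷ ws) (extend y g fresh j e) (trans (+-suc k _) size)
    ... | no stuck = inj₂ (ws , g , subst (length ws <_) size (s≤s (m≤n+m (length ws) k)) , stuck⇒closed ws stuck)

    explore : ∀ x B → 1 ≤ B → Outcome x B
    explore x B 1≤B = explore-from (B ∸ 1) (x ∷ []) start (m∸n+n≡m 1≤B)

    -- the whole set reachable from x: an exploration cannot list N + 1
    -- distinct vertices of Fin N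
    component : ∀ x → Σ _ λ ws → Explored x ws × Closed ws
    component x with explore x (suc N) (s≤s z≤n)
    ... | inj₂ (ws , g , _ , cl) = ws , g , cl
    ... | inj₁ (ws , g , size) with pigeonhole (subst (suc N ≤_) (sym size) ≤-refl) (lookup ws)
    ...   | i , j , i<j , eq = ⊥-elim (<-irrefl (cong toℕ (explored-injective g i j eq)) i<j)

record SmallEquivalence (v d : ℕ) : Set₁ where
  field
    _∼_        : Fin v → Fin v → Set
    _∼?_       : ∀ a b → Dec (a ∼ b)
    ∼-refl     : ∀ a → a ∼ a
    ∼-sym      : ∀ {a b} → a ∼ b → b ∼ a
    ∼-trans    : ∀ {a b c} → a ∼ b → b ∼ c → a ∼ c
    class      : Fin v → List (Fin v)
    ∈-class    : ∀ {a b} → a ∼ b → b ∈ class a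
    class-size : ∀ a → length (class a) ≤ d

missing-colour : ∀ {d} (cs : List (Fin d)) → length cs < d → Σ (Fin d) λ α → α ∉ cs
missing-colour {d} cs lt with any? (λ α → ¬? (Any.any? (α FinP.≟_) cs))
... | yes (α , α∉) = α , α∉
... | no none-missing = ⊥-elim (no-collision (pigeonhole lt position))
  where
  all-in : ∀ α → α ∈ cs
  all-in α with Any.any? (α FinP.≟_) cs
  ... | yes α∈ = α∈
  ... | no α∉ = ⊥-elim (none-missing (α , α∉))
  position : Fin d → Fin (length cs)
  position α = Any.index (all-in α)
  no-collision : (∃₂ λ i j → Data.Fin._<_ i j × position i ≡ position j) → ⊥
  no-collision (i , j , i<j , eq) = <-irrefl (cong toℕ
    (trans (lookup-index (all-in i)) (trans (cong (lookup cs) eq) (sym (lookup-index (all-in j)))))) i<j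

-- Vertices are coloured in the order of their positions; below-suc and
-- below⇒≢ describe the vertices preceding x (at position m) and x itself.
below-suc : ∀ {v m} (x y : Fin v) → toℕ x ≡ m → toℕ y < suc m → toℕ y < m ⊎ y ≡ x
below-suc x y x≡m y≤m with m≤n⇒m<n∨m≡n (s≤s⁻¹ y≤m)
... | inj₁ y<m = inj₁ y<m
... | inj₂ y≡m = inj₂ (toℕ-injective (trans y≡m (sym x≡m)))

below⇒≢ : ∀ {v m} (x y : Fin v) → toℕ x ≡ m → toℕ y < m → y ≢ x
below⇒≢ x y x≡m y<m refl = <-irrefl x≡m y<m

update-below : ∀ {v d m} (c : Fin v → Fin d) (x : Fin v) α y → toℕ x ≡ m → toℕ y < m →
               updateAt c x (const α) y ≡ c y
update-below c x α y x≡m y<m = updateAt-minimal y x c (below⇒≢ x y x≡m y<m)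

module _ {v d : ℕ} (Q : SmallEquivalence v d) where
  open SmallEquivalence Q

  ProperBelow : ℕ → (Fin v → Fin d) → Set
  ProperBelow m c = ∀ y z → toℕ y < m → toℕ z < m → y ≢ z → y ∼ z → c y ≢ c z

  Avoids : ℕ → (Fin v → Fin d) → Fin v → Fin d → Set
  Avoids m c x α = ∀ y → toℕ y < m → x ∼ y → c y ≢ α

  -- x lies in its own class but not below position m, so fewer than d
  -- colours occur on its earlier mates
  free-colour : ∀ c m x → toℕ x ≡ m → Σ (Fin d) (Avoids m c x)
  free-colour c m x x≡m = α , avoids
    where
    earlier = filter (λ y → toℕ y <? m) (class x)
    x-late : Any (λ y → ¬ (toℕ y < m)) (class x)
    x-late = Any.map (λ { refl → <-irrefl x≡m }) (∈-class (∼-refl x))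
    few : length (map c earlier) < d
    few = subst (_< d) (sym (length-map c earlier))
            (≤-trans (filter-notAll (λ y → toℕ y <? m) (class x) x-late) (class-size x))
    α = proj₁ (missing-colour (map c earlier) few)
    avoids : Avoids m c x α
    avoids y y<m xy cy≡α = proj₂ (missing-colour (map c earlier) few)
      (subst (_∈ map c earlier) cy≡α (∈-map⁺ c (∈-filter⁺ (λ y → toℕ y <? m) (∈-class xy) y<m)))

  colour-next : ∀ m c x α → toℕ x ≡ m → ProperBelow m c → Avoids m c x α →
                ProperBelow (suc m) (updateAt c x (const α))
  colour-next m c x α x≡m proper avoids y z y≤m z≤m y≢z yz clash
    with below-suc x y x≡m y≤m | below-suc x z x≡m z≤m
  ... | inj₁ y<m | inj₁ z<m = proper y z y<m z<m y≢z yz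
    (trans (sym (update-below c x α y x≡m y<m)) (trans clash (update-below c x α z x≡m z<m)))
  ... | inj₂ refl | inj₁ z<m = avoids z z<m yz
    (trans (sym (update-below c x α z x≡m z<m)) (trans (sym clash) (updateAt-updates x c)))
  ... | inj₁ y<m | inj₂ refl = avoids y y<m (∼-sym yz)
    (trans (sym (update-below c x α y x≡m y<m)) (trans clash (updateAt-updates x c)))
  ... | inj₂ refl | inj₂ refl = y≢z refl

-- König's theorem for two partitions: if R and B are decidable equivalence
-- relations on Fin v with all classes of size at most d, some colouring
-- Fin v → Fin d is injective on every R-class and every B-class.  (This is
-- König's edge-colouring theorem for the bipartite multigraph whose vertices
-- are the classes and whose edges are the elements of Fin v.)  Elements are
-- coloured one at a time, recolouring a Kempe chain where necessary.
module König {v d : ℕ} (ℛ ℬ : SmallEquivalence v d) where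
  open SmallEquivalence ℛ using () renaming (_∼_ to _∼R_; ∼-sym to ∼R-sym; ∼-trans to ∼R-trans)
  open SmallEquivalence ℬ using () renaming
    (_∼_ to _∼B_; _∼?_ to _∼B?_; ∼-sym to ∼B-sym; ∼-trans to ∼B-trans)

  Proper : ℕ → (Fin v → Fin d) → Set
  Proper m c = ProperBelow ℛ m c × ProperBelow ℬ m c

  -- x (at position m) has a free colour α at its R-class and a free colour
  -- β at its B-class, but α is used at its B-class, by e₀.  Swapping α and
  -- β on the α/β-chain through e₀ frees α at both classes of x.
  module KempeSwitch (m : ℕ) (c : Fin v → Fin d) (properR : ProperBelow ℛ m c) (properB : ProperBelow ℬ m c)
    (x : Fin v) (α β : Fin d) (freeR : Avoids ℛ m c x α) (freeB : Avoids ℬ m c x β)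
    (e₀ : Fin v) (e₀<m : toℕ e₀ < m) (x∼e₀ : x ∼B e₀) (ce₀ : c e₀ ≡ α) where

    -- e₀ uses α at the B-class of x, where β is free
    α≢β : α ≢ β
    α≢β α≡β = freeB e₀ e₀<m x∼e₀ (trans ce₀ α≡β)

    Link : Fin v → Fin v → Set
    Link y z = toℕ y < m × toℕ z < m × y ≢ z ×
               ((c y ≡ α × c z ≡ β × y ∼R z) ⊎ (c y ≡ β × c z ≡ α × y ∼B z))

    Link? : ∀ y z → Dec (Link y z)
    Link? y z = (toℕ y <? m) ×-dec (toℕ z <? m) ×-dec ¬? (y FinP.≟ z) ×-dec
      (((c y FinP.≟ α) ×-dec (c z FinP.≟ β) ×-dec SmallEquivalence._∼?_ ℛ y z)
       ⊎-dec ((c y FinP.≟ β) ×-dec (c z FinP.≟ α) ×-dec y ∼B? z))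

    open Exploration Link using (Explored; Closed; closed-reach; explored-start; member-reach; component)

    chain : List (Fin v)
    chain = proj₁ (component Link? e₀)

    chain-explored : Explored e₀ chain
    chain-explored = proj₁ (proj₂ (component Link? e₀))

    chain-closed : Closed chain
    chain-closed = proj₂ (proj₂ (component Link? e₀))

    InChain : Fin v → Set
    InChain y = Mem y chain

    reached : ∀ {y} → Star Link e₀ y → InChain y
    reached = closed-reach {chain} chain-closed (explored-start chain-explored)

    path-to : ∀ {y} → InChain y → Star Link e₀ y
    path-to = member-reach chain-explored

    step-into : ∀ {y z} → InChain y → Link y z → InChain z
    step-into y∈ l = closed-reach {chain} chain-closed y∈ (l ◅ ε)

    chain-colours : ∀ {y} → Star Link e₀ y → toℕ y < m × (c y ≡ α ⊎ c y ≡ β)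
    chain-colours p with unsnoc p
    ... | inj₁ refl = e₀<m , inj₁ ce₀
    ... | inj₂ (_ , _ , (_ , z<m , _ , inj₁ (_ , cz≡β , _))) = z<m , inj₂ cz≡β
    ... | inj₂ (_ , _ , (_ , z<m , _ , inj₂ (_ , cz≡α , _))) = z<m , inj₁ cz≡α

    swap : Fin d → Fin d
    swap = transpose α β

    swap-α : swap α ≡ β
    swap-α rewrite dec-true (α FinP.≟ α) refl = refl

    swap-β : swap β ≡ α
    swap-β rewrite dec-false (β FinP.≟ α) (α≢β ∘ sym) | dec-true (β FinP.≟ β) refl = refl

    swap-injective : ∀ {γ δ} → swap γ ≡ swap δ → γ ≡ δ
    swap-injective {γ} {δ} eq =
      trans (sym (transpose-inverse β α)) (trans (cong (transpose β α) eq) (transpose-inverse β α))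

    c′ : Fin v → Fin d
    c′ y with mem? y chain
    ... | yes _ = swap (c y)
    ... | no _  = c y

    c′-in : ∀ y → InChain y → c′ y ≡ swap (c y)
    c′-in y y∈ with mem? y chain
    ... | yes _ = refl
    ... | no y∉ = ⊥-elim (y∉ y∈)

    c′-out : ∀ y → ¬ InChain y → c′ y ≡ c y
    c′-out y y∉ with mem? y chain
    ... | yes y∈ = ⊥-elim (y∉ y∈)
    ... | no _  = refl

    -- a clash after the switch across the boundary of the chain: the chain
    -- would continue to z, or z clashed with the chain's predecessor of y
    boundaryR : ∀ y z → InChain y → ¬ InChain z → toℕ z < m → y ≢ z → y ∼R z → swap (c y) ≢ c z
    boundaryR y z y∈ z∉ z<m y≢z yz clash with chain-colours (path-to y∈)
    ... | y<m , inj₁ cy≡α =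
      z∉ (step-into y∈ (y<m , z<m , y≢z , inj₁ (cy≡α , trans (sym clash) (trans (cong swap cy≡α) swap-α) , yz)))
    ... | y<m , inj₂ cy≡β with unsnoc (path-to y∈)
    ...   | inj₁ refl = α≢β (trans (sym ce₀) cy≡β)
    ...   | inj₂ (p , _ , (_ , _ , _ , inj₂ (_ , cy≡α , _))) = α≢β (trans (sym cy≡α) cy≡β)
    ...   | inj₂ (p , e₀⇝p , (p<m , _ , _ , inj₁ (cp≡α , _ , py))) with p FinP.≟ z
    ...     | yes refl = z∉ (reached e₀⇝p)
    ...     | no p≢z = properR p z p<m z<m p≢z (∼R-trans py yz)
                (trans cp≡α (sym (trans (sym clash) (trans (cong swap cy≡β) swap-β))))

    -- the same across B-classes; when y = e₀ itself, z would be a B-mate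
    -- of x coloured β
    boundaryB : ∀ y z → InChain y → ¬ InChain z → toℕ z < m → y ≢ z → y ∼B z → swap (c y) ≢ c z
    boundaryB y z y∈ z∉ z<m y≢z yz clash with chain-colours (path-to y∈)
    ... | y<m , inj₂ cy≡β =
      z∉ (step-into y∈ (y<m , z<m , y≢z , inj₂ (cy≡β , trans (sym clash) (trans (cong swap cy≡β) swap-β) , yz)))
    ... | y<m , inj₁ cy≡α with unsnoc (path-to y∈)
    ...   | inj₁ refl = freeB z z<m (∼B-trans x∼e₀ yz) (trans (sym clash) (trans (cong swap cy≡α) swap-α))
    ...   | inj₂ (p , _ , (_ , _ , _ , inj₁ (_ , cy≡β , _))) = α≢β (trans (sym cy≡α) cy≡β)
    ...   | inj₂ (p , e₀⇝p , (p<m , _ , _ , inj₂ (cp≡β , _ , py))) with p FinP.≟ z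
    ...     | yes refl = z∉ (reached e₀⇝p)
    ...     | no p≢z = properB p z p<m z<m p≢z (∼B-trans py yz)
                (trans cp≡β (sym (trans (sym clash) (trans (cong swap cy≡α) swap-α))))

    switch-proper : (Q : SmallEquivalence v d) → ProperBelow Q m c →
      (∀ y z → InChain y → ¬ InChain z → toℕ z < m → y ≢ z → SmallEquivalence._∼_ Q y z → swap (c y) ≢ c z) →
      ProperBelow Q m c′
    switch-proper Q proper boundary y z y<m z<m y≢z yz clash = by-cases (mem? y chain) (mem? z chain)
      where
      by-cases : Dec (InChain y) → Dec (InChain z) → ⊥
      by-cases (yes y∈) (yes z∈) = proper y z y<m z<m y≢z yz
        (swap-injective (trans (sym (c′-in y y∈)) (trans clash (c′-in z z∈))))
      by-cases (no y∉) (no z∉) = proper y z y<m z<m y≢z yz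
        (trans (sym (c′-out y y∉)) (trans clash (c′-out z z∉)))
      by-cases (yes y∈) (no z∉) = boundary y z y∈ z∉ z<m y≢z yz
        (trans (sym (c′-in y y∈)) (trans clash (c′-out z z∉)))
      by-cases (no y∉) (yes z∈) = boundary z y z∈ y∉ y<m (y≢z ∘ sym) (SmallEquivalence.∼-sym Q yz)
        (trans (sym (c′-in z z∈)) (trans (sym clash) (c′-out y y∉)))

    -- after the switch α is free at the R-class of x: an R-mate coloured
    -- β before the switch would be reached from an α-vertex R-related to x
    avoidsR : Avoids ℛ m c′ x α
    avoidsR y y<m xy c′y≡α = by-cases (mem? y chain)
      where
      β-before : InChain y → c y ≡ β
      β-before y∈ = swap-injective (trans (sym (c′-in y y∈)) (trans c′y≡α (sym swap-β)))
      by-cases : Dec (InChain y) → ⊥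
      by-cases (no y∉) = freeR y y<m xy (trans (sym (c′-out y y∉)) c′y≡α)
      by-cases (yes y∈) with unsnoc (path-to y∈)
      ... | inj₁ refl = α≢β (trans (sym ce₀) (β-before y∈))
      ... | inj₂ (p , _ , (_ , _ , _ , inj₂ (_ , cy≡α , _))) = α≢β (trans (sym cy≡α) (β-before y∈))
      ... | inj₂ (p , _ , (p<m , _ , _ , inj₁ (cp≡α , _ , py))) = freeR p p<m (∼R-trans xy (∼R-sym py)) cp≡α

    -- and at the B-class of x: outside the chain α could only sit on e₀
    avoidsB : Avoids ℬ m c′ x α
    avoidsB y y<m xy c′y≡α = by-cases (mem? y chain)
      where
      by-cases : Dec (InChain y) → ⊥
      by-cases (yes y∈) = freeB y y<m xy
        (swap-injective (trans (sym (c′-in y y∈)) (trans c′y≡α (sym swap-β))))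
      by-cases (no y∉) with y FinP.≟ e₀
      ... | yes refl = y∉ (explored-start chain-explored)
      ... | no y≢e₀ = properB y e₀ y<m e₀<m y≢e₀ (∼B-trans (∼B-sym xy) x∼e₀)
                        (trans (trans (sym (c′-out y y∉)) c′y≡α) (sym ce₀))

    switched : Proper m c′ × Avoids ℛ m c′ x α × Avoids ℬ m c′ x α
    switched = (switch-proper ℛ properR boundaryR , switch-proper ℬ properB boundaryB) , avoidsR , avoidsB

  common-free-colour : ∀ m x → toℕ x ≡ m → ∀ c → Proper m c →
    Σ (Fin v → Fin d) λ c′ → Proper m c′ × Σ (Fin d) λ α → Avoids ℛ m c′ x α × Avoids ℬ m c′ x α
  common-free-colour m x x≡m c (properR , properB)
    with free-colour ℛ c m x x≡m | free-colour ℬ c m x x≡m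
  ... | α , freeR | β , freeB with any? (λ y → (toℕ y <? m) ×-dec (x ∼B? y) ×-dec (c y FinP.≟ α))
  ...   | no unused = c , (properR , properB) , α , freeR , λ y y<m xy cy≡α → unused (y , y<m , xy , cy≡α)
  ...   | yes (e₀ , e₀<m , x∼e₀ , ce₀) with KempeSwitch.switched m c properR properB x α β freeR freeB e₀ e₀<m x∼e₀ ce₀
  ...     | proper′ , avoidsR , avoidsB = _ , proper′ , α , avoidsR , avoidsB

  -- an initial colouring; Fin d is inhabited as soon as Fin v is, since
  -- every class contains at least its own representative
  initial : Fin v → Fin d
  initial y with SmallEquivalence.class ℛ y | SmallEquivalence.∈-class ℛ (SmallEquivalence.∼-refl ℛ y)
    | SmallEquivalence.class-size ℛ y
  ... | _ ∷ _ | _ | 1≤d = fromℕ< 1≤d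

  colour-below : ∀ m → m ≤ v → Σ (Fin v → Fin d) (Proper m)
  colour-below zero _ = initial , (λ y z ()) , (λ y z ())
  colour-below (suc m) m<v with colour-below m (<⇒≤ m<v)
  ... | c , proper with common-free-colour m (fromℕ< m<v) (toℕ-fromℕ< m<v) c proper
  ... | c′ , (properR , properB) , α , avoidsR , avoidsB =
    updateAt c′ (fromℕ< m<v) (const α)
    , colour-next ℛ m c′ _ α (toℕ-fromℕ< m<v) properR avoidsR
    , colour-next ℬ m c′ _ α (toℕ-fromℕ< m<v) properB avoidsB

  könig : Σ (Fin v → Fin d) λ c →
    (∀ y z → y ≢ z → y ∼R z → c y ≢ c z) × (∀ y z → y ≢ z → y ∼B z → c y ≢ c z)
  könig with colour-below v ≤-refl
  ... | c , properR , properB =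
    c , (λ y z → properR y z (toℕ<n y) (toℕ<n z)) , (λ y z → properB y z (toℕ<n y) (toℕ<n z))

first-or-all : ∀ {k} {A : Set} {P : Fin k → Set} → (∀ i → A ⊎ P i) → A ⊎ (∀ i → P i)
first-or-all {zero} _ = inj₂ λ ()
first-or-all {suc k} h with h zero | first-or-all (h ∘ suc)
... | inj₁ a  | _       = inj₁ a
... | inj₂ _  | inj₁ a  = inj₁ a
... | inj₂ p  | inj₂ ps = inj₂ λ { zero → p ; (suc i) → ps i }

module Monochromatic {v : ℕ} (G : Graph v) (f : Fin v → Fin v → Fin 2)
  (f-sym : ∀ x y → Adj G x y → f x y ≡ f y x) where

  Coloured : Fin 2 → Fin v → Fin v → Set
  Coloured κ a b = Adj G a b × f a b ≡ κ

  Coloured? : ∀ κ a b → Dec (Coloured κ a b)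
  Coloured? κ a b = (adj G a b BoolP.≟ true) ×-dec (f a b FinP.≟ κ)

  Coloured-sym : ∀ {κ a b} → Coloured κ a b → Coloured κ b a
  Coloured-sym {κ} {a} {b} (e , fab≡κ) = adj-sym G e , trans (sym (f-sym a b e)) fab≡κ

  module Along (κ : Fin 2) = Exploration (Coloured κ)

  explored⇒tree : ∀ κ {x ws} → Along.Explored κ x ws → MonochromaticTree G f (length ws)
  explored⇒tree κ {x} {ws} g =
    tree , is-tree , κ , lookup ws , (λ {i} {j} → Along.explored-injective κ g i j) , coloured-edge
    where
    open ParentTree (Along.parent κ g) (Along.parent-climbs κ g) (Along.root κ g) (Along.fixed⇒root κ g)
    coloured-edge : ∀ i j → Adj tree i j → Coloured κ (lookup ws i) (lookup ws j)
    coloured-edge i j a with adj⇒rel a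
    ... | i≢j , inj₁ pi≡j = Coloured-sym (subst (λ z → Coloured κ (lookup ws z) (lookup ws i)) pi≡j
      (Along.parent-edge κ g i (λ pi≡i → i≢j (trans (sym pi≡i) pi≡j))))
    ... | i≢j , inj₂ pj≡i = subst (λ z → Coloured κ (lookup ws z) (lookup ws j)) pj≡i
      (Along.parent-edge κ g j (λ pj≡j → i≢j (trans (sym pj≡i) pj≡j)))

  SmallComponent : ℕ → Fin 2 → Fin v → Set
  SmallComponent d κ x =
    Σ (List (Fin v)) λ ws → Along.Explored κ x ws × length ws ≤ d × Along.Closed κ ws

  tree-or-small : ∀ d κ x → MonochromaticTree G f (suc d) ⊎ SmallComponent d κ x
  tree-or-small d κ x with Along.explore κ (Coloured? κ) x (suc d) (s≤s z≤n)
  ... | inj₁ (ws , g , size) = inj₁ (subst (MonochromaticTree G f) size (explored⇒tree κ g))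
  ... | inj₂ (ws , g , size , closed) = inj₂ (ws , g , s≤s⁻¹ size , closed)

  -- if all monochromatic components have at most d vertices, G is
  -- d-colourable: colour by König's theorem applied to the two partitions
  -- into components; the ends of an edge of colour κ share a κ-component
  module SmallComponents (d : ℕ) (small : ∀ κ x → SmallComponent d κ x) where

    component : Fin 2 → Fin v → List (Fin v)
    component κ x = proj₁ (small κ x)

    explored : ∀ κ x → Along.Explored κ x (component κ x)
    explored κ x = proj₁ (proj₂ (small κ x))

    closed : ∀ κ x → Along.Closed κ (component κ x)
    closed κ x = proj₂ (proj₂ (proj₂ (small κ x)))

    reach⇒same : ∀ κ {a b} → Star (Coloured κ) a b → Mem b (component κ a)
    reach⇒same κ {a} = Along.closed-reach κ {component κ a} (closed κ a) (Along.explored-start κ (explored κ a))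

    components : Fin 2 → SmallEquivalence v d
    components κ = record
      { _∼_ = λ a b → Mem b (component κ a)
      ; _∼?_ = λ a b → mem? b (component κ a)
      ; ∼-refl = λ a → reach⇒same κ ε
      ; ∼-sym = λ {a} ab → reach⇒same κ (reverse Coloured-sym (Along.member-reach κ (explored κ a) ab))
      ; ∼-trans = λ {a} {b} ab bc → reach⇒same κ
          (Along.member-reach κ (explored κ a) ab ◅◅
           Along.member-reach κ (explored κ b) bc)
      ; class = component κ
      ; ∈-class = λ { {a} (j , refl) → ∈-lookup j }
      ; class-size = λ a → proj₁ (proj₂ (proj₂ (small κ a)))
      }

    colourable : Colorable G d
    colourable = c , λ x y xy → separates (f x y) x y (adj⇒≢ G xy) (reach⇒same (f x y) ((xy , refl) ◅ ε))
      where
      open König (components zero) (components (suc zero)) using (könig)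
      c = proj₁ könig
      separates : ∀ κ x y → x ≢ y → Mem y (component κ x) → c x ≢ c y
      separates zero = proj₁ (proj₂ könig)
      separates (suc zero) = proj₂ (proj₂ könig)

theorem1 : (n : ℕ) → 0 < n → (v : ℕ) → (G : Graph v) → ChromaticNumber G n →
    (f : EdgeColoring G 2) → MonochromaticTree G (proj₁ f) n
theorem1 (suc d) _ v G (_ , not-d-colourable) (f , f-sym) =
  [ id , (λ small → ⊥-elim (not-d-colourable d (n<1+n d) (SmallComponents.colourable d small))) ]′
    (first-or-all (λ κ → first-or-all (tree-or-small d κ)))
  where open Monochromatic G f f-sym
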